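{- For each $n<\omega$ and each $A\in\mathcal{F}^\nabla_n$ there is a word $W\in\mathcal{W}_n$ such that $\nabla_nA=\nabla_nW$ is provable in $\mathrm{RC}^\nabla$.
   Context: Strictly positive formulas are built from propositional variables and $\top$ by $\land$ and unary modalities $\Diamond_n,\nabla_n$ ($n<\omega$). $\mathcal{F}^\nabla_n$ is the set of variable-free strictly positive formulas using only the modalities $\Diamond_i,\nabla_i$ with $i\ge n$. A word is a variable-free formula built from $\top$ using only $\Diamond$-modalities (no $\land$, no $\nabla$), i.e. $\Diamond_{i_1}\cdots\Diamond_{i_k}\top$; $\mathcal{W}_n$ is the set of words using only $\Diamond_i$ with $i\ge n$. $\mathrm{RC}^\nabla$ is the smallest set of sequents $A\vdash B$ containing the following axioms and closed under the following rules and under substitution: (1) $A\vdash A$; $A\vdash\top$; $A\land B\vdash A$; $A\land B\vdash B$; from $A\vdash B$, $B\vdash C$ infer $A\vdash C$; from $A\vdash B$, $A\vdash C$ infer $A\vdash B\land C$; from $A\vdash B$ infer $aA\vdash aB$ for each modality $a$; (2) $aaA\vdash aA$ for each modality $a$; (3) for $m<n$: $\Diamond_nA\vdash\Diamond_mA$, $\Diamond_nA\land\Diamond_mB\vdash\Diamond_n(A\land\Diamond_mB)$, and the same two with $\nabla$ in place of $\Diamond$; (4) $A\vdash\nabla_nA$, $\Diamond_nA\vdash\nabla_nA$; (5) for $m\le n$: $\Diamond_m\nabla_nA\vdash\Diamond_mA$, $\nabla_n\Diamond_mA\vdash\Diamond_mA$. $A=B$ means provability of $A\vdash B$ and $B\vdash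 A$. -}

module Defs where

open import Data.Nat using (ℕ; _≤_; _<_)
open import Data.Product using (_×_)

data Fm : Set where
  var  : ℕ → Fm
  ⊤'   : Fm
  _∧_  : Fm → Fm → Fm
  ◇    : ℕ → Fm → Fm
  ∇    : ℕ → Fm → Fm

infixr 6 _∧_

-- Modalities as a datatype, so that rules "for each modality a" can be stated.
data Mod : Set where
  dia  : ℕ → Mod
  nab  : ℕ → Mod

app : Mod → Fm → Fm
app (dia n) A = ◇ n A
app (nab n) A = ∇ n A

subst : (ℕ → Fm) → Fm → Fm
subst σ (var x)  = σ x
subst σ ⊤'       = ⊤'
subst σ (A ∧ B)  = subst σ A ∧ subst σ B
subst σ (◇ n A)  = ◇ n (subst σ A)
subst σ (∇ n A)  = ∇ n (subst σ A)

infix 4 _⊢_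
data _⊢_ : Fm → Fm → Set where
  refl⊢  : ∀ {A} → A ⊢ A
  top    : ∀ {A} → A ⊢ ⊤'
  ∧E₁    : ∀ {A B} → A ∧ B ⊢ A
  ∧E₂    : ∀ {A B} → A ∧ B ⊢ B
  cut    : ∀ {A B C} → A ⊢ B → B ⊢ C → A ⊢ C
  ∧I     : ∀ {A B C} → A ⊢ B → A ⊢ C → A ⊢ B ∧ C
  mono   : ∀ {A B} (a : Mod) → A ⊢ B → app a A ⊢ app a B
  trans4 : ∀ {A} (a : Mod) → app a (app a A) ⊢ app a A
  ◇mono  : ∀ {m n A} → m < n → ◇ n A ⊢ ◇ m A
  ◇J     : ∀ {m n A B} → m < n → ◇ n A ∧ ◇ m B ⊢ ◇ n (A ∧ ◇ m B)
  ∇mono  : ∀ {m n A} → m < n → ∇ n A ⊢ ∇ m A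
  ∇J     : ∀ {m n A B} → m < n → ∇ n A ∧ ∇ m B ⊢ ∇ n (A ∧ ∇ m B)
  ∇refl  : ∀ {n A} → A ⊢ ∇ n A
  ◇∇     : ∀ {n A} → ◇ n A ⊢ ∇ n A
  ◇∇◇    : ∀ {m n A} → m ≤ n → ◇ m (∇ n A) ⊢ ◇ m A
  ∇◇◇    : ∀ {m n A} → m ≤ n → ∇ n (◇ m A) ⊢ ◇ m A
  sub    : ∀ {A B} (σ : ℕ → Fm) → A ⊢ B → subst σ A ⊢ subst σ B

_≡⊢_ : Fm → Fm → Set
A ≡⊢ B = (A ⊢ B) × (B ⊢ A)

data F∇ (n : ℕ) : Fm → Set where
  ⊤-F : F∇ n ⊤'
  ∧-F : ∀ {A B} → F∇ n A → F∇ n B → F∇ n (A ∧ B)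
  ◇-F : ∀ {i A} → n ≤ i → F∇ n A → F∇ n (◇ i A)
  ∇-F : ∀ {i A} → n ≤ i → F∇ n A → F∇ n (∇ i A)

data Word (n : ℕ) : Fm → Set where
  ⊤-W : Word n ⊤'
  ◇-W : ∀ {i A} → n ≤ i → Word n A → Word n (◇ i A)

-- Over a fixed level m any two words are comparable: for W, V ∈ W_m either
-- V ⊢ ∇_m W or W ⊢ ◇_m V. A word with all indices ≥ m factors as H ∧ ◇_m T with
-- H ∈ W_{m+1} and T ∈ W_m (cut it at its first ◇_m), so the dichotomy follows by
-- induction on a weight, comparing the two tails at level m and the two heads
-- at level m+1. Consequently any conjunction of formulas ◇_n W, ∇_n W collapses
-- to one of them. Modalities of index > n commute with conjunctions with such
-- formulas, so every A ∈ F^∇_n is equivalent to H ∧ L with H ∈ F^∇_{n+1} and L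
-- one of ⊤, ◇_n W, ∇_n W. Under ∇_n the conjunct H may be replaced by ∇_{n+1} H,
-- which by induction on the number of levels occurring in A is ∇_{n+1} h for a
-- word h; finally ∇_n (h ∧ L) is ∇_n of a word.
module Submission where

open import Defs
open import Data.Nat using (ℕ; zero; suc; _+_; _∸_; _≤_; _<_; z≤n; s≤s)
open import Data.Nat.Properties
open import Data.Product using (Σ; _×_; _,_; proj₁; proj₂)
open import Data.Sum using (_⊎_; inj₁; inj₂; swap)
open import Data.Empty using (⊥-elim)
open import Level using (0ℓ)
open import Relation.Binary.Bundles using (Setoid)
open import Relation.Binary.Structures using (IsEquivalence)
open import Relation.Binary.PropositionalEquality using (refl; sym)
import Relation.Binary.Reasoning.Setoid as SetoidReasoning

infixr 5 _∙_
_∙_ : ∀ {A B C} → A ⊢ B → B ⊢ C → A ⊢ C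
_∙_ = cut

≡⊢-isEquivalence : IsEquivalence _≡⊢_
≡⊢-isEquivalence = record
  { refl  = refl⊢ , refl⊢
  ; sym   = λ (p , q) → q , p
  ; trans = λ (p , q) (r , s) → p ∙ r , s ∙ q
  }

≡⊢-setoid : Setoid 0ℓ 0ℓ
≡⊢-setoid = record { isEquivalence = ≡⊢-isEquivalence }

module ≡⊢ = IsEquivalence ≡⊢-isEquivalence

infixr 3 _⟫_
_⟫_ : ∀ {A B C} → A ≡⊢ B → B ≡⊢ C → A ≡⊢ C
_⟫_ = ≡⊢.trans

∧-mono : ∀ {A A' B B'} → A ⊢ A' → B ⊢ B' → A ∧ B ⊢ A' ∧ B'
∧-mono p q = ∧I (∧E₁ ∙ p) (∧E₂ ∙ q)

∧-cong : ∀ {A A' B B'} → A ≡⊢ A' → B ≡⊢ B' → (A ∧ B) ≡⊢ (A' ∧ B')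
∧-cong (p , q) (r , s) = ∧-mono p r , ∧-mono q s

∧-interchange : ∀ {A B C D} → ((A ∧ B) ∧ (C ∧ D)) ≡⊢ ((A ∧ C) ∧ (B ∧ D))
∧-interchange = swap-middle , swap-middle
  where
  swap-middle : ∀ {A B C D} → (A ∧ B) ∧ (C ∧ D) ⊢ (A ∧ C) ∧ (B ∧ D)
  swap-middle = ∧I (∧-mono ∧E₁ ∧E₁) (∧-mono ∧E₂ ∧E₂)

∧-identityˡ : ∀ {A} → (⊤' ∧ A) ≡⊢ A
∧-identityˡ = ∧E₂ , ∧I top refl⊢

∧-identityʳ : ∀ {A} → (A ∧ ⊤') ≡⊢ A
∧-identityʳ = ∧E₁ , ∧I refl⊢ top

⊢⇒∧≡⊢ˡ : ∀ {A B} → A ⊢ B → (A ∧ B) ≡⊢ A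
⊢⇒∧≡⊢ˡ p = ∧E₁ , ∧I refl⊢ p

⊢⇒∧≡⊢ʳ : ∀ {A B} → B ⊢ A → (A ∧ B) ≡⊢ B
⊢⇒∧≡⊢ʳ p = ∧E₂ , ∧I p refl⊢

◇-map : ∀ {A B} n → A ⊢ B → ◇ n A ⊢ ◇ n B
◇-map n = mono (dia n)

∇-map : ∀ {A B} n → A ⊢ B → ∇ n A ⊢ ∇ n B
∇-map n = mono (nab n)

◇-cong : ∀ {A B} n → A ≡⊢ B → ◇ n A ≡⊢ ◇ n B
◇-cong n (p , q) = ◇-map n p , ◇-map n q

∇-cong : ∀ {A B} n → A ≡⊢ B → ∇ n A ≡⊢ ∇ n B
∇-cong n (p , q) = ∇-map n p , ∇-map n q

◇-lower : ∀ {m i A} → m ≤ i → ◇ i A ⊢ ◇ m A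
◇-lower m≤i with m≤n⇒m<n∨m≡n m≤i
... | inj₁ m<i = ◇mono m<i
... | inj₂ refl = refl⊢

◇∇⊢◇ : ∀ {n A} → ◇ n (∇ n A) ⊢ ◇ n A
◇∇⊢◇ = ◇∇◇ ≤-refl

∇◇⊢◇ : ∀ {n A} → ∇ n (◇ n A) ⊢ ◇ n A
∇◇⊢◇ = ∇◇◇ ≤-refl

lift : ∀ {A B} (a : Mod) → A ⊢ app a B → app a A ⊢ app a B
lift a p = mono a p ∙ trans4 a

◇-lift-∇ : ∀ {n A B} → A ⊢ ∇ n B → ◇ n A ⊢ ◇ n B
◇-lift-∇ {n} p = ◇-map n p ∙ ◇∇⊢◇

∇-lift-◇ : ∀ {n A B} → A ⊢ ◇ n B → ∇ n A ⊢ ◇ n B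
∇-lift-◇ {n} p = ∇-map n p ∙ ∇◇⊢◇

◇-cong-∇ : ∀ {n A B} → ∇ n A ≡⊢ ∇ n B → ◇ n A ≡⊢ ◇ n B
◇-cong-∇ (p , q) = ◇-lift-∇ (∇refl ∙ p) , ◇-lift-∇ (∇refl ∙ q)

◇◇-float : ∀ {m j U Y} → m < j → ◇ j (U ∧ ◇ m Y) ≡⊢ (◇ j U ∧ ◇ m Y)
◇◇-float {m} {j} m<j = ∧I (◇-map j ∧E₁) (◇-map j ∧E₂ ∙ ◇mono m<j ∙ trans4 (dia m))
                     , ◇J m<j

◇∇-float : ∀ {m j U Y} → m < j → ◇ j (U ∧ ∇ m Y) ≡⊢ (◇ j U ∧ ◇ m Y)
◇∇-float {m} {j} m<j = ∧I (◇-map j ∧E₁) (◇-map j ∧E₂ ∙ ◇mono m<j ∙ ◇∇⊢◇)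
                     , (◇J m<j ∙ ◇-map j (∧-mono refl⊢ ◇∇))

∇◇-float : ∀ {m j U Y} → m < j → ∇ j (U ∧ ◇ m Y) ≡⊢ (∇ j U ∧ ◇ m Y)
∇◇-float {m} {j} m<j = ∧I (∇-map j ∧E₁) (∇-map j ∧E₂ ∙ ∇◇◇ (<⇒≤ m<j))
                     , (∧-mono refl⊢ ∇refl ∙ ∇J m<j ∙ ∇-map j (∧-mono refl⊢ ∇◇⊢◇))

∇∇-float : ∀ {m j U Y} → m < j → ∇ j (U ∧ ∇ m Y) ≡⊢ (∇ j U ∧ ∇ m Y)
∇∇-float {m} {j} m<j = ∧I (∇-map j ∧E₁) (∇-map j ∧E₂ ∙ ∇mono m<j ∙ trans4 (nab m))
                     , ∇J m<j

∇-guard-conjunct : ∀ {n H L} → ∇ n L ⊢ L → ∇ n (H ∧ L) ≡⊢ ∇ n (∇ (suc n) H ∧ L)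
∇-guard-conjunct {n} ∇L⊢L =
    ∇-map n (∧-mono ∇refl refl⊢)
  , lift (nab n) (∧-mono refl⊢ ∇refl ∙ proj₂ (∇∇-float (n<1+n n))
                  ∙ ∇-map (suc n) (∧-mono refl⊢ ∇L⊢L) ∙ ∇mono (n<1+n n))

∇-conjunct-cong : ∀ {n H H' L} → ∇ n L ⊢ L → ∇ (suc n) H ≡⊢ ∇ (suc n) H' →
                  ∇ n (H ∧ L) ≡⊢ ∇ n (H' ∧ L)
∇-conjunct-cong {n} {H} {H'} {L} ∇L⊢L H≡H' = begin
  ∇ n (H ∧ L)             ≈⟨ ∇-guard-conjunct ∇L⊢L ⟩
  ∇ n (∇ (suc n) H ∧ L)   ≈⟨ ∇-cong n (∧-cong H≡H' ≡⊢.refl) ⟩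
  ∇ n (∇ (suc n) H' ∧ L)  ≈⟨ ∇-guard-conjunct ∇L⊢L ⟨
  ∇ n (H' ∧ L)            ∎
  where open SetoidReasoning ≡⊢-setoid

Word-weaken : ∀ {m k h} → m ≤ k → Word k h → Word m h
Word-weaken m≤k ⊤-W = ⊤-W
Word-weaken m≤k (◇-W k≤i w) = ◇-W (≤-trans m≤k k≤i) (Word-weaken m≤k w)

append : ∀ {k h} → Word k h → Fm → Fm
append ⊤-W t = t
append (◇-W {i} _ w) t = ◇ i (append w t)

append-Word : ∀ {m k h t} → m ≤ k → (wh : Word k h) → Word m t → Word m (append wh t)
append-Word m≤k ⊤-W wt = wt
append-Word m≤k (◇-W k≤i wh) wt = ◇-W (≤-trans m≤k k≤i) (append-Word m≤k wh wt)

append-◇ : ∀ {m k h t} → m < k → (wh : Word k h) → append wh (◇ m t) ≡⊢ (h ∧ ◇ m t)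
append-◇ m<k ⊤-W = ≡⊢.sym ∧-identityˡ
append-◇ m<k (◇-W {i} k≤i wh) = ◇-cong i (append-◇ m<k wh) ⟫ ◇◇-float (<-≤-trans m<k k≤i)

weight : ℕ → Fm → ℕ
weight m (◇ i x) = suc (i ∸ m) + weight m x
weight m _ = 0

record Decomposition (m : ℕ) (X : Fm) : Set where
  field
    head : Fm
    tail : Fm
    head-word : Word (suc m) head
    tail-word : Word m tail
    ≡-head∧tail : X ≡⊢ (head ∧ ◇ m tail)
    head-lighter : weight (suc m) head < weight m X
    tail-lighter : weight m tail < weight m X
open Decomposition

decompose : ∀ {m i A} → m ≤ i → Word m A → Decomposition m (◇ i A)
decompose {m} {i} {A} m≤i wA with m≤n⇒m<n∨m≡n m≤i
... | inj₂ refl = record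
  { head = ⊤' ; tail = A ; head-word = ⊤-W ; tail-word = wA
  ; ≡-head∧tail = ≡⊢.sym ∧-identityˡ
  ; head-lighter = s≤s z≤n
  ; tail-lighter = s≤s (m≤n+m (weight m A) (m ∸ m)) }
... | inj₁ m<i with wA
...   | ⊤-W = record
  { head = ◇ i ⊤' ; tail = ⊤' ; head-word = ◇-W m<i ⊤-W ; tail-word = ⊤-W
  ; ≡-head∧tail = ∧I refl⊢ (◇mono m<i) , ∧E₁
  ; head-lighter = s≤s (+-mono-<-≤ (∸-monoʳ-< (n<1+n m) m<i) z≤n)
  ; tail-lighter = s≤s z≤n }
...   | ◇-W m≤j wA' = let d = decompose m≤j wA' in record
  { head = ◇ i (head d) ; tail = tail d ; head-word = ◇-W m<i (head-word d)
  ; tail-word = tail-word d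
  ; ≡-head∧tail = ◇-cong i (≡-head∧tail d) ⟫ ◇◇-float m<i
  ; head-lighter = s≤s (+-mono-<-≤ (∸-monoʳ-< (n<1+n m) m<i) (<⇒≤ (head-lighter d)))
  ; tail-lighter = <-≤-trans (tail-lighter d) (m≤n+m _ (suc (i ∸ m))) }

Comparable : ℕ → Fm → Fm → Set
Comparable m X Y = Y ⊢ ∇ m X ⊎ X ⊢ ◇ m Y

-- Compare the tails first; if neither decides, the heads settle it one level up.
comparable-from-parts : ∀ {m X Y} (dX : Decomposition m X) (dY : Decomposition m Y) →
  Comparable m X (tail dY) → Comparable m Y (tail dX) →
  Comparable (suc m) (head dX) (head dY) → Comparable m X Y
comparable-from-parts dX dY (inj₁ tY⊢∇X) _ _ =
  inj₁ (proj₁ (≡-head∧tail dY) ∙ ∧E₂ ∙ ◇-lift-∇ tY⊢∇X ∙ ◇∇)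
comparable-from-parts dX dY (inj₂ _) (inj₁ tX⊢∇Y) _ =
  inj₂ (proj₁ (≡-head∧tail dX) ∙ ∧E₂ ∙ ◇-lift-∇ tX⊢∇Y)
comparable-from-parts {m} dX dY (inj₂ X⊢◇tY) (inj₂ Y⊢◇tX) (inj₁ hY⊢∇hX) =
  inj₁ (∧I (proj₁ (≡-head∧tail dY) ∙ ∧E₁ ∙ hY⊢∇hX) Y⊢◇tX ∙ proj₂ (∇◇-float (n<1+n m))
        ∙ ∇-map (suc m) (proj₂ (≡-head∧tail dX)) ∙ ∇mono (n<1+n m))
comparable-from-parts {m} dX dY (inj₂ X⊢◇tY) (inj₂ _) (inj₂ hX⊢◇hY) =
  inj₂ (∧I (proj₁ (≡-head∧tail dX) ∙ ∧E₁ ∙ hX⊢◇hY) X⊢◇tY ∙ proj₂ (◇◇-float (n<1+n m))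
        ∙ ◇-map (suc m) (proj₂ (≡-head∧tail dY)) ∙ ◇mono (n<1+n m))

words-comparable-bounded : ∀ k {m X Y} → Word m X → Word m Y →
                           weight m X + weight m Y < k → Comparable m X Y
words-comparable-bounded k ⊤-W wY _ = inj₁ (top ∙ ∇refl)
words-comparable-bounded k (◇-W {i} m≤i wx) ⊤-W _ = inj₂ (◇-map i top ∙ ◇-lower m≤i)
words-comparable-bounded (suc k) {m} {X} {Y} wX@(◇-W m≤i wx) wY@(◇-W m≤j wy) (s≤s X+Y≤k) =
  comparable-from-parts dX dY
    (words-comparable-bounded k wX (tail-word dY)
       (<-≤-trans (+-monoʳ-< (weight m X) (tail-lighter dY)) X+Y≤k))
    (words-comparable-bounded k wY (tail-word dX)
       (<-≤-trans (+-monoʳ-< (weight m Y) (tail-lighter dX))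
                  (≤-trans (≤-reflexive (+-comm (weight m Y) (weight m X))) X+Y≤k)))
    (words-comparable-bounded k (head-word dX) (head-word dY)
       (<-≤-trans (+-mono-< (head-lighter dX) (head-lighter dY)) X+Y≤k))
  where
  dX = decompose m≤i wx
  dY = decompose m≤j wy

words-comparable : ∀ {m X Y} → Word m X → Word m Y → Comparable m X Y
words-comparable {m} {X} {Y} wX wY =
  words-comparable-bounded (suc (weight m X + weight m Y)) wX wY ≤-refl

data Atom (n : ℕ) : Set where
  none : Atom n
  dia nab : (W : Fm) → Word n W → Atom n

⟦_⟧ : ∀ {n} → Atom n → Fm
⟦ none ⟧ = ⊤'
⟦_⟧ {n} (dia W _) = ◇ n W
⟦_⟧ {n} (nab W _) = ∇ n W

⟦⟧-∇-closed : ∀ {n} (a : Atom n) → ∇ n ⟦ a ⟧ ⊢ ⟦ a ⟧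
⟦⟧-∇-closed none = top
⟦⟧-∇-closed (dia W _) = ∇◇⊢◇
⟦⟧-∇-closed {n} (nab W _) = trans4 (nab n)

atoms-total : ∀ {n} (a b : Atom n) → ⟦ a ⟧ ⊢ ⟦ b ⟧ ⊎ ⟦ b ⟧ ⊢ ⟦ a ⟧
atoms-total none b = inj₂ top
atoms-total (dia W w) none = inj₁ top
atoms-total (nab W w) none = inj₁ top
atoms-total {n} (dia W w) (dia V v) with words-comparable w v
... | inj₁ V⊢∇W = inj₂ (◇-lift-∇ V⊢∇W)
... | inj₂ W⊢◇V = inj₁ (lift (dia n) W⊢◇V)
atoms-total {n} (nab W w) (nab V v) with words-comparable w v
... | inj₁ V⊢∇W = inj₂ (lift (nab n) V⊢∇W)
... | inj₂ W⊢◇V = inj₁ (∇-lift-◇ W⊢◇V ∙ ◇∇)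
atoms-total (dia W w) (nab V v) with words-comparable v w
... | inj₁ W⊢∇V = inj₁ (◇-lift-∇ W⊢∇V ∙ ◇∇)
... | inj₂ V⊢◇W = inj₂ (∇-lift-◇ V⊢◇W)
atoms-total (nab W w) (dia V v) = swap (atoms-total (dia V v) (nab W w))

atom-∧ : ∀ {n} (a b : Atom n) → Σ (Atom n) λ c → (⟦ a ⟧ ∧ ⟦ b ⟧) ≡⊢ ⟦ c ⟧
atom-∧ a b with atoms-total a b
... | inj₁ a⊢b = a , ⊢⇒∧≡⊢ˡ a⊢b
... | inj₂ b⊢a = b , ⊢⇒∧≡⊢ʳ b⊢a

toDia : ∀ {n} → Atom n → Atom n
toDia (nab W w) = dia W w
toDia a = a

◇-float : ∀ {n j U} → n < j → (a : Atom n) → ◇ j (U ∧ ⟦ a ⟧) ≡⊢ (◇ j U ∧ ⟦ toDia a ⟧)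
◇-float {n} {j} n<j none = ◇-cong j ∧-identityʳ ⟫ ≡⊢.sym ∧-identityʳ
◇-float n<j (dia W w) = ◇◇-float n<j
◇-float n<j (nab W w) = ◇∇-float n<j

∇-float : ∀ {n j U} → n < j → (a : Atom n) → ∇ j (U ∧ ⟦ a ⟧) ≡⊢ (∇ j U ∧ ⟦ a ⟧)
∇-float {n} {j} n<j none = ∇-cong j ∧-identityʳ ⟫ ≡⊢.sym ∧-identityʳ
∇-float n<j (dia W w) = ∇◇-float n<j
∇-float n<j (nab W w) = ∇∇-float n<j

WordNF : ℕ → Fm → Set
WordNF n A = Σ Fm λ W → Word n W × (∇ n A ≡⊢ ∇ n W)

WordNF-word : ∀ {n W} → Word n W → WordNF n W
WordNF-word {W = W} w = W , w , ≡⊢.refl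

WordNF-respects : ∀ {n A B} → ∇ n A ≡⊢ ∇ n B → WordNF n B → WordNF n A
WordNF-respects A≡B (W , w , B≡W) = W , w , (A≡B ⟫ B≡W)

∇-word-∧-◇ : ∀ {n h t} → Word (suc n) h → Word n t → WordNF n (h ∧ ◇ n t)
∇-word-∧-◇ {n} {h} {t} wh wt =
  WordNF-respects (∇-cong n (≡⊢.sym (append-◇ (n<1+n n) wh)))
                  (WordNF-word (append-Word (n≤1+n n) wh (◇-W ≤-refl wt)))

-- Write V = h' ∧ ◇_n t and compare h with h' one level up: either V absorbs h
-- under ∇_n, or ∇_n V may be replaced by ◇_n t.
∇-word-∧-∇ : ∀ {n h V} → Word (suc n) h → Word n V → WordNF n (h ∧ ∇ n V)
∇-word-∧-∇ {n} wh ⊤-W =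
  WordNF-respects (∇-cong n (⊢⇒∧≡⊢ˡ (top ∙ ∇refl))) (WordNF-word (Word-weaken (n≤1+n n) wh))
∇-word-∧-∇ {n} {h} {V} wh wV@(◇-W n≤j wV') = compare-heads (decompose n≤j wV')
  where
  compare-heads : Decomposition n V → WordNF n (h ∧ ∇ n V)
  compare-heads dV with words-comparable wh (head-word dV)
  ... | inj₁ h'⊢∇h =
    WordNF-respects (∇-map n ∧E₂ ∙ trans4 (nab n) , V-absorbs-h) (WordNF-word wV)
    where
    V-absorbs-h : ∇ n V ⊢ ∇ n (h ∧ ∇ n V)
    V-absorbs-h = lift (nab n) (∧I (proj₁ (≡-head∧tail dV) ∙ ∧E₁ ∙ h'⊢∇h) ∇refl
                                ∙ proj₂ (∇∇-float (n<1+n n)) ∙ ∇mono (n<1+n n))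
  ... | inj₂ h⊢◇h' = WordNF-respects (∇-cong n ∇V-by-tail) (∇-word-∧-◇ wh (tail-word dV))
    where
    ∇V-by-tail : (h ∧ ∇ n V) ≡⊢ (h ∧ ◇ n (tail dV))
    ∇V-by-tail = ∧-mono refl⊢ (∇-lift-◇ (proj₁ (≡-head∧tail dV) ∙ ∧E₂))
               , ∧I ∧E₁ (∧-mono h⊢◇h' refl⊢ ∙ proj₂ (◇◇-float (n<1+n n))
                         ∙ ◇-map (suc n) (proj₂ (≡-head∧tail dV)) ∙ ◇mono (n<1+n n) ∙ ◇∇)

∇-word-∧-atom : ∀ {n h} → Word (suc n) h → (a : Atom n) → WordNF n (h ∧ ⟦ a ⟧)
∇-word-∧-atom {n} wh none =
  WordNF-respects (∇-cong n ∧-identityʳ) (WordNF-word (Word-weaken (n≤1+n n) wh))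
∇-word-∧-atom wh (dia W w) = ∇-word-∧-◇ wh w
∇-word-∧-atom wh (nab V v) = ∇-word-∧-∇ wh v

data Below (b : ℕ) : Fm → Set where
  ⊤-B : Below b ⊤'
  ∧-B : ∀ {A B} → Below b A → Below b B → Below b (A ∧ B)
  ◇-B : ∀ {i A} → i < b → Below b A → Below b (◇ i A)
  ∇-B : ∀ {i A} → i < b → Below b A → Below b (∇ i A)

Below-weaken : ∀ {b b' A} → b ≤ b' → Below b A → Below b' A
Below-weaken b≤b' ⊤-B = ⊤-B
Below-weaken b≤b' (∧-B bA bB) = ∧-B (Below-weaken b≤b' bA) (Below-weaken b≤b' bB)
Below-weaken b≤b' (◇-B i<b bA) = ◇-B (<-≤-trans i<b b≤b') (Below-weaken b≤b' bA)
Below-weaken b≤b' (∇-B i<b bA) = ∇-B (<-≤-trans i<b b≤b') (Below-weaken b≤b' bA)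

indexBound : Fm → ℕ
indexBound (A ∧ B) = indexBound A + indexBound B
indexBound (◇ i A) = suc i + indexBound A
indexBound (∇ i A) = suc i + indexBound A
indexBound _ = 0

Below-indexBound : ∀ {n A} → F∇ n A → Below (indexBound A) A
Below-indexBound ⊤-F = ⊤-B
Below-indexBound (∧-F {A} {B} fA fB) =
  ∧-B (Below-weaken (m≤m+n (indexBound A) (indexBound B)) (Below-indexBound fA))
      (Below-weaken (m≤n+m (indexBound B) (indexBound A)) (Below-indexBound fB))
Below-indexBound (◇-F {i} {A} _ fA) =
  ◇-B (s≤s (m≤m+n i (indexBound A)))
      (Below-weaken (m≤n+m (indexBound A) (suc i)) (Below-indexBound fA))
Below-indexBound (∇-F {i} {A} _ fA) =
  ∇-B (s≤s (m≤m+n i (indexBound A)))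
      (Below-weaken (m≤n+m (indexBound A) (suc i)) (Below-indexBound fA))

F∇-Below-≡⊤ : ∀ {n A} → F∇ n A → Below n A → A ≡⊢ ⊤'
F∇-Below-≡⊤ ⊤-F ⊤-B = ≡⊢.refl
F∇-Below-≡⊤ (∧-F fA fB) (∧-B bA bB) =
  ∧-cong (F∇-Below-≡⊤ fA bA) (F∇-Below-≡⊤ fB bB) ⟫ ∧-identityˡ
F∇-Below-≡⊤ (◇-F n≤i _) (◇-B i<n _) = ⊥-elim (<⇒≱ i<n n≤i)
F∇-Below-≡⊤ (∇-F n≤i _) (∇-B i<n _) = ⊥-elim (<⇒≱ i<n n≤i)

record Split (n b : ℕ) (A : Fm) : Set where
  constructor split
  field
    upper : Fm
    upper-F∇ : F∇ (suc n) upper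
    upper-Below : Below b upper
    atom : Atom n
    split-≡ : A ≡⊢ (upper ∧ ⟦ atom ⟧)

Split-⊤ : ∀ {n b} → Split n b ⊤'
Split-⊤ = split ⊤' ⊤-F ⊤-B none (≡⊢.sym ∧-identityʳ)

Split-∧ : ∀ {n b A B} → Split n b A → Split n b B → Split n b (A ∧ B)
Split-∧ (split H₁ f₁ b₁ a₁ A≡) (split H₂ f₂ b₂ a₂ B≡) =
  let (a , a₁∧a₂≡a) = atom-∧ a₁ a₂ in
  split (H₁ ∧ H₂) (∧-F f₁ f₂) (∧-B b₁ b₂) a
        (∧-cong A≡ B≡ ⟫ ∧-interchange ⟫ ∧-cong ≡⊢.refl a₁∧a₂≡a)

Split-◇ : ∀ {n b j X} → n < j → j < b → Split n b X → Split n b (◇ j X)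
Split-◇ {j = j} n<j j<b (split H f bH a X≡) =
  split (◇ j H) (◇-F n<j f) (◇-B j<b bH) (toDia a) (◇-cong j X≡ ⟫ ◇-float n<j a)

Split-∇ : ∀ {n b j X} → n < j → j < b → Split n b X → Split n b (∇ j X)
Split-∇ {j = j} n<j j<b (split H f bH a X≡) =
  split (∇ j H) (∇-F n<j f) (∇-B j<b bH) a (∇-cong j X≡ ⟫ ∇-float n<j a)

Split-◇-atom : ∀ {n b X} → WordNF n X → Split n b (◇ n X)
Split-◇-atom (W , wW , X≡W) = split ⊤' ⊤-F ⊤-B (dia W wW) (◇-cong-∇ X≡W ⟫ ≡⊢.sym ∧-identityˡ)

Split-∇-atom : ∀ {n b X} → WordNF n X → Split n b (∇ n X)
Split-∇-atom (W , wW , X≡W) = split ⊤' ⊤-F ⊤-B (nab W wW) (X≡W ⟫ ≡⊢.sym ∧-identityˡ)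

WordNF-from-Split : ∀ {n b A} (s : Split n b A) → WordNF (suc n) (Split.upper s) → WordNF n A
WordNF-from-Split {n} (split H _ _ a A≡) (h , wh , H≡h) =
  WordNF-respects (∇-cong n A≡ ⟫ ∇-conjunct-cong (⟦⟧-∇-closed a) H≡h) (∇-word-∧-atom wh a)

-- Mutual recursion on the number d of levels that may still occur in A, and on A.
mutual
  normalise : ∀ d {n b A} → F∇ n A → Below b A → b ≤ d + n → WordNF n A
  normalise zero {n} fA bA b≤n =
    WordNF-respects (∇-cong n (F∇-Below-≡⊤ fA (Below-weaken b≤n bA))) (WordNF-word ⊤-W)
  normalise (suc d) {n} fA bA b≤ =
    let s = splitLevel (suc d) fA bA b≤ in
    WordNF-from-Split s (normalise d (Split.upper-F∇ s) (Split.upper-Below s)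
                                     (≤-trans b≤ (≤-reflexive (sym (+-suc d n)))))

  splitLevel : ∀ d {n b A} → F∇ n A → Below b A → b ≤ d + n → Split n b A
  splitLevel d ⊤-F ⊤-B _ = Split-⊤
  splitLevel d (∧-F fA fB) (∧-B bA bB) b≤ =
    Split-∧ (splitLevel d fA bA b≤) (splitLevel d fB bB b≤)
  splitLevel d (◇-F n≤j fX) (◇-B j<b bX) b≤ with m≤n⇒m<n∨m≡n n≤j
  ... | inj₁ n<j = Split-◇ n<j j<b (splitLevel d fX bX b≤)
  ... | inj₂ refl = Split-◇-atom (normalise d fX bX b≤)
  splitLevel d (∇-F n≤j fX) (∇-B j<b bX) b≤ with m≤n⇒m<n∨m≡n n≤j
  ... | inj₁ n<j = Split-∇ n<j j<b (splitLevel d fX bX b≤)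
  ... | inj₂ refl = Split-∇-atom (normalise d fX bX b≤)

theorem2 : (n : ℕ) (A : Fm) → F∇ n A →
    Σ Fm (λ W → Word n W × (∇ n A ≡⊢ ∇ n W))
theorem2 n A fA = normalise (indexBound A) fA (Below-indexBound fA) (m≤m+n (indexBound A) n)
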